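{- There exists an integer constant $\kappa>1$ and a deterministic distributed algorithm in the $\mathcal{LOCAL}$ model such that, for any infinite line $G$ whose nodes are labeled with integers greater than $1$ forming a proper colouring of $G$, the algorithm properly 3-colours $G$ (each node outputs a colour in $\{0,1,2\}$ different from the colours output by its neighbours), and the execution at any node $x$ with label $\mathrm{ID}_x$ terminates within at most $\kappa\log^*(\mathrm{ID}_x)$ rounds. The nodes have no initial knowledge about the network other than their own label.
   Context: The infinite line is the infinite connected graph in which every node has degree 2. In the $\mathcal{LOCAL}$ model, all nodes start simultaneously, computation proceeds in synchronous rounds, and in each round every node may exchange arbitrary messages with all its neighbours and perform arbitrary local computation; a node terminates by outputting its colour and stopping. A labeling of the nodes by integers is a proper colouring if adjacent nodes receive different integers. $\log^*$ is the base-2 iterated logarithm: $\log^*(n)=0$ if $n\le1$, else $1+\log^*(\log_2 n)$. -}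

module Defs where

open import Data.Nat using (ℕ; zero; suc; _+_; _*_; _<_; _≤ᵇ_)
open import Data.Nat.Logarithm using (⌈log₂_⌉)
open import Data.Bool using (Bool; true; false; if_then_else_)
open import Data.Fin using (Fin)
import Data.Fin as Fin
open import Data.Maybe using (Maybe; just; nothing)
open import Data.Integer using (ℤ; -_) renaming (_+_ to _+ℤ_)
import Data.Integer as ℤ
open import Data.Product using (Σ; _×_; _,_)
open import Relation.Binary.PropositionalEquality using (_≡_; _≢_)

-- For natural n we iterate ⌈log₂⌉: since ⌈log₂ ⌈y⌉⌉ = ⌈log₂ y⌉ and
-- y > 1 ⇔ ⌈y⌉ > 1, this gives exactly the real-valued log*.
-- Fuel n suffices because ⌈log₂ n⌉ < n for n ≥ 2.

logStarFuel : ℕ → ℕ → ℕ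
logStarFuel zero    n = 0
logStarFuel (suc f) n = if n ≤ᵇ 1 then 0 else suc (logStarFuel f ⌈log₂ n ⌉)

log* : ℕ → ℕ
log* n = logStarFuel n n

-- The infinite line: nodes are ℤ, x adjacent to x+1.
-- Labels: ℓ : ℤ → ℕ.

ProperLabeling : (ℤ → ℕ) → Set
ProperLabeling ℓ = (x : ℤ) → ℓ x ≢ ℓ (x +ℤ ℤ.+ 1)

-- Each node has two ports, 0 and 1.  In each round every
-- non-terminated node sends a message on each port, receives the
-- messages on its ports (nothing from a terminated or silent neighbour),
-- and computes a new state.  A node has terminated once `out` of its
-- state is `just c`; it then stops (keeps its state, sends nothing).

record LocalAlgorithm : Set₁ where
  field
    State   : Set
    Msg     : Set
    init    : ℕ → State
    send    : State → Fin 2 → Msg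
    step    : State → Maybe Msg → Maybe Msg → State
    out     : State → Maybe (Fin 3)

-- Port numbering: π x = true means port 0 of x leads to x-1 and port 1 to
-- x+1; π x = false means the reverse.  Chosen adversarially.

PortNumbering : Set
PortNumbering = ℤ → Bool

module Execution (A : LocalAlgorithm) (ℓ : ℤ → ℕ) (π : PortNumbering) where
  open LocalAlgorithm A

  left right : ℤ → ℤ
  left  x = x ℤ.- ℤ.+ 1
  right x = x +ℤ ℤ.+ 1

  portL portR : ℤ → Fin 2
  portL x = if π x then Fin.zero else Fin.suc Fin.zero
  portR x = if π x then Fin.suc Fin.zero else Fin.zero

  emit : State → Fin 2 → Maybe Msg
  emit s p with out s
  ... | just _  = nothing
  ... | nothing = just (send s p)

  run : ℕ → ℤ → State
  run zero    x = init (ℓ x)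
  run (suc t) x with out (run t x)
  ... | just _  = run t x
  ... | nothing =
    let fromL = emit (run t (left x))  (portR (left x))
        fromR = emit (run t (right x)) (portL (right x))
    in if π x then step (run t x) fromL fromR
              else step (run t x) fromR fromL

  output : ℕ → ℤ → Maybe (Fin 3)
  output t x = out (run t x)

{-# OPTIONS --safe #-}

-- A node x of rank L = log* ℓ(x) first runs L rounds of Cole–Vishkin colour
-- reduction, listening only to neighbours of its own rank.  Since ℓ(x) ≤ tower L,
-- this leaves a colour cv(x) < 1024 that differs from the colour of every
-- neighbour of the same rank, so the decision round D(x) = cv(x) + 1024 L differs
-- between any two neighbours and comes before the halting round 2048 L.  In round
-- D(x) the node picks a colour of {0,1,2} avoiding the decisions it has heard.
-- Every node broadcasts its state until it halts, so of two neighbours the later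
-- one has heard the decision of the earlier one and avoids it.

module Submission where

open import Defs
open import Data.Nat
open import Data.Nat.Properties
open import Data.Nat.DivMod using (m≡m%n+[m/n]*n; m%n<n; m<n⇒m%n≡m; [m+kn]%n≡m%n; m<n*o⇒m/o<n)
open import Data.Nat.Logarithm using (⌈log₂_⌉)
open import Data.Nat.Logarithm.Core using (⌈log2⌉)
open import Data.Nat.Induction using (<-wellFounded)
open import Data.Nat.Tactic.RingSolver using (solve-∀)
open import Data.Bool using (true; false; if_then_else_)
open import Data.Fin using (Fin; zero; suc; punchIn; punchOut)
import Data.Fin as Fin
open import Data.Fin.Properties using (punchInᵢ≢i; punchIn-injective; punchIn-punchOut)
open import Data.Integer using (ℤ)
import Data.Integer as ℤ
import Data.Integer.Properties as ℤ
open import Data.Vec using (_∷_; []; lookup)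
open import Data.Maybe using (Maybe; just; nothing; maybe′; fromMaybe)
open import Data.Maybe.Properties using (just-injective)
open import Data.Product using (Σ; _×_; _,_; proj₁; proj₂)
open import Data.Sum using (inj₁; inj₂)
open import Induction.WellFounded using (Acc; acc)
open import Relation.Nullary using (does; yes; no; contradiction)
open import Relation.Nullary.Decidable using (dec-true; dec-false)
open import Relation.Binary.Definitions using (tri<; tri≈; tri>)
open import Relation.Binary.PropositionalEquality

induction-from : ∀ {p} (P : ℕ → Set p) {a} → P a → (∀ {t} → a ≤ t → P t → P (suc t)) →
                 ∀ {t} → a ≤ t → P t
induction-from P Pa step {zero}  z≤n = Pa
induction-from P Pa step {suc t} a≤1+t with m≤n⇒m<n∨m≡n a≤1+t
... | inj₁ a<1+t = step (s≤s⁻¹ a<1+t) (induction-from P Pa step (s≤s⁻¹ a<1+t))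
... | inj₂ refl  = Pa

n<2^n : ∀ n → n < 2 ^ n
n<2^n zero    = s≤s z≤n
n<2^n (suc n) = ≤-<-trans (n<2^n n) (m<m+n (2 ^ n) (≤-trans (m^n>0 2 n) (m≤m+n (2 ^ n) 0)))

m∸n≡1+[m∸1+n] : ∀ {m n} → n < m → m ∸ n ≡ suc (m ∸ suc n)
m∸n≡1+[m∸1+n] {suc m} {zero}  _         = refl
m∸n≡1+[m∸1+n] {suc m} {suc n} (s≤s n<m) = m∸n≡1+[m∸1+n] n<m

digits-injective : ∀ n .{{_ : NonZero n}} {u u′ v v′} → v < n → v′ < n →
                   v + u * n ≡ v′ + u′ * n → v ≡ v′ × u ≡ u′
digits-injective n {u} {u′} {v} {v′} v<n v′<n eq =
  v≡v′ , *-cancelʳ-≡ u u′ n (+-cancelˡ-≡ v _ _ (trans eq (cong (_+ u′ * n) (sym v≡v′))))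
  where
    open ≡-Reasoning
    v≡v′ : v ≡ v′
    v≡v′ = begin
      v                 ≡⟨ m<n⇒m%n≡m v<n ⟨
      v % n             ≡⟨ [m+kn]%n≡m%n v u n ⟨
      (v + u * n) % n   ≡⟨ cong (_% n) eq ⟩
      (v′ + u′ * n) % n ≡⟨ [m+kn]%n≡m%n v′ u′ n ⟩
      v′ % n            ≡⟨ m<n⇒m%n≡m v′<n ⟩
      v′                ∎

digits-bound : ∀ {n u v} → v < n → u < n → v + u * n < n * n
digits-bound {n} {u} {v} v<n u<n = begin-strict
  v + u * n  <⟨ +-monoˡ-< (u * n) v<n ⟩
  n + u * n  ≤⟨ *-monoˡ-≤ n u<n ⟩
  n * n      ∎
  where open ≤-Reasoning

tower : ℕ → ℕ
tower zero    = 1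
tower (suc m) = 2 ^ tower m

1≤tower : ∀ m → 1 ≤ tower m
1≤tower zero    = ≤-refl
1≤tower (suc m) = m^n>0 2 (tower m)

n≤⌈n/2⌉+⌈n/2⌉ : ∀ n → n ≤ ⌈ n /2⌉ + ⌈ n /2⌉
n≤⌈n/2⌉+⌈n/2⌉ n =
  subst (_≤ ⌈ n /2⌉ + ⌈ n /2⌉) (⌊n/2⌋+⌈n/2⌉≡n n) (+-monoˡ-≤ ⌈ n /2⌉ (⌊n/2⌋≤⌈n/2⌉ n))

n≤2^⌈log2⌉n : ∀ n (rec : Acc _<_ n) → n ≤ 2 ^ ⌈log2⌉ n rec
n≤2^⌈log2⌉n zero          _        = z≤n
n≤2^⌈log2⌉n (suc zero)    _        = s≤s z≤n
n≤2^⌈log2⌉n (suc (suc n)) (acc rs) = begin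
  2 + n                                          ≤⟨ +-monoʳ-≤ 2 (n≤⌈n/2⌉+⌈n/2⌉ n) ⟩
  2 + (⌈ n /2⌉ + ⌈ n /2⌉)                        ≡⟨ cong suc (+-suc ⌈ n /2⌉ ⌈ n /2⌉) ⟨
  suc ⌈ n /2⌉ + suc ⌈ n /2⌉                      ≤⟨ +-mono-≤ ih (≤-trans ih (m≤m+n _ 0)) ⟩
  2 * 2 ^ ⌈log2⌉ (suc ⌈ n /2⌉) (rs (⌈n/2⌉<n n)) ∎
  where
    open ≤-Reasoning
    ih = n≤2^⌈log2⌉n (suc ⌈ n /2⌉) (rs (⌈n/2⌉<n n))

⌈log2⌉n<n : ∀ n (rec : Acc _<_ n) → 1 ≤ n → ⌈log2⌉ n rec < n
⌈log2⌉n<n (suc zero)    _        _ = s≤s z≤n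
⌈log2⌉n<n (suc (suc n)) (acc rs) _ =
  s≤s (≤-trans (⌈log2⌉n<n (suc ⌈ n /2⌉) (rs (⌈n/2⌉<n n)) (s≤s z≤n)) (s≤s (⌈n/2⌉≤n n)))

n≤tower[logStarFuel] : ∀ f n → n ≤ f → n ≤ tower (logStarFuel f n)
n≤tower[logStarFuel] zero    zero          _         = z≤n
n≤tower[logStarFuel] (suc f) zero          _         = z≤n
n≤tower[logStarFuel] (suc f) (suc zero)    _         = ≤-refl
n≤tower[logStarFuel] (suc f) (suc (suc n)) (s≤s n<f) = begin
  2 + n                               ≤⟨ n≤2^⌈log2⌉n (2 + n) (<-wellFounded (2 + n)) ⟩
  2 ^ ⌈log₂ 2 + n ⌉                   ≤⟨ ^-monoʳ-≤ 2 (n≤tower[logStarFuel] f _ log≤f) ⟩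
  tower (logStarFuel (suc f) (2 + n)) ∎
  where
    open ≤-Reasoning
    log≤f : ⌈log₂ 2 + n ⌉ ≤ f
    log≤f = s≤s⁻¹ (≤-trans (⌈log2⌉n<n (2 + n) (<-wellFounded (2 + n)) (s≤s z≤n)) (s≤s n<f))

n≤tower[log*n] : ∀ n → n ≤ tower (log* n)
n≤tower[log*n] n = n≤tower[logStarFuel] n n ≤-refl

1≤log* : ∀ {n} → 1 < n → 1 ≤ log* n
1≤log* {suc zero}    (s≤s ())
1≤log* {suc (suc n)} _ = s≤s z≤n

bit : ℕ → ℕ → ℕ
bit zero    a = a % 2
bit (suc i) a = bit i (a / 2)

bit<2 : ∀ i a → bit i a < 2
bit<2 zero    a = m%n<n a 2
bit<2 (suc i) a = bit<2 i (a / 2)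

firstDiff : ℕ → ℕ → ℕ → ℕ
firstDiff zero    a b = zero
firstDiff (suc k) a b with a % 2 ≟ b % 2
... | yes _ = suc (firstDiff k (a / 2) (b / 2))
... | no  _ = zero

firstDiff≤ : ∀ k a b → firstDiff k a b ≤ k
firstDiff≤ zero    a b = z≤n
firstDiff≤ (suc k) a b with a % 2 ≟ b % 2
... | yes _ = s≤s (firstDiff≤ k (a / 2) (b / 2))
... | no  _ = z≤n

bit-firstDiff-≢ : ∀ k {a b} → a < 2 ^ k → b < 2 ^ k → a ≢ b →
                  bit (firstDiff k a b) a ≢ bit (firstDiff k a b) b
bit-firstDiff-≢ zero    {zero}  {zero}  _       _       a≢b = contradiction refl a≢b
bit-firstDiff-≢ zero    {suc a} (s≤s ())
bit-firstDiff-≢ zero    {zero}  {suc b} _       (s≤s ())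
bit-firstDiff-≢ (suc k) {a}     {b}     a<2^k b<2^k a≢b with a % 2 ≟ b % 2
... | no  a%2≢b%2 = a%2≢b%2
... | yes a%2≡b%2 = bit-firstDiff-≢ k (half< a<2^k) (half< b<2^k) halves-differ
  where
    half< : ∀ {c} → c < 2 ^ suc k → c / 2 < 2 ^ k
    half< {c} c< = m<n*o⇒m/o<n (subst (c <_) (*-comm 2 (2 ^ k)) c<)
    halves-differ : a / 2 ≢ b / 2
    halves-differ a/2≡b/2 = a≢b (begin
      a                 ≡⟨ m≡m%n+[m/n]*n a 2 ⟩
      a % 2 + a / 2 * 2 ≡⟨ cong₂ (λ r q → r + q * 2) a%2≡b%2 a/2≡b/2 ⟩
      b % 2 + b / 2 * 2 ≡⟨ m≡m%n+[m/n]*n b 2 ⟨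
      b                 ∎)
      where open ≡-Reasoning

cvColour : ℕ → ℕ → Maybe ℕ → ℕ
cvColour k a nothing  = 0
cvColour k a (just b) = suc (bit (firstDiff k a b) a + firstDiff k a b * 2)

palette : ℕ → ℕ
palette k = 3 + k * 2

cvColour<palette : ∀ k a m → cvColour k a m < palette k
cvColour<palette k a nothing  = s≤s z≤n
cvColour<palette k a (just b) =
  s≤s (s≤s (+-mono-≤ (s≤s⁻¹ (bit<2 (firstDiff k a b) a)) (*-monoˡ-≤ 2 (firstDiff≤ k a b))))

cvColour-proper : ∀ k {a b} m → a < 2 ^ k → b < 2 ^ k → a ≢ b →
                  cvColour k a (just b) ≢ cvColour k b m
cvColour-proper k {a} {b} (just c) a<2^k b<2^k a≢b eq =
  bit-firstDiff-≢ k a<2^k b<2^k a≢b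
    (trans (proj₁ digits≡) (cong (λ i → bit i b) (sym (proj₂ digits≡))))
  where
    i = firstDiff k a b
    j = firstDiff k b c
    digits≡ : bit i a ≡ bit j b × i ≡ j
    digits≡ = digits-injective 2 (bit<2 i a) (bit<2 j b) (suc-injective eq)

-- Each node compares itself with both neighbours and combines the two
-- Cole–Vishkin colours, so the line need not be oriented.
reduce : ℕ → ℕ → Maybe ℕ → Maybe ℕ → ℕ
reduce k a m₀ m₁ = cvColour k a m₀ + cvColour k a m₁ * palette k

reduce<palette² : ∀ k a m₀ m₁ → reduce k a m₀ m₁ < palette k * palette k
reduce<palette² k a m₀ m₁ = digits-bound (cvColour<palette k a m₀) (cvColour<palette k a m₁)

reduce-proper : ∀ k {a b} (m m′ : Fin 2 → Maybe ℕ) p →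
                a < 2 ^ k → b < 2 ^ k → a ≢ b → m p ≡ just b →
                reduce k a (m zero) (m (suc zero)) ≢ reduce k b (m′ zero) (m′ (suc zero))
reduce-proper k {a} {b} m m′ p a<2^k b<2^k a≢b mp≡b eq =
  cvColour-proper k (m′ p) a<2^k b<2^k a≢b (on-port p mp≡b)
  where
    col = cvColour k
    digits≡ : col a (m zero) ≡ col b (m′ zero) × col a (m (suc zero)) ≡ col b (m′ (suc zero))
    digits≡ = digits-injective (palette k) (cvColour<palette k a (m zero)) (cvColour<palette k b (m′ zero)) eq
    on-port : ∀ p → m p ≡ just b → col a (just b) ≡ col b (m′ p)
    on-port zero       m₀≡b = subst (λ v → col a v ≡ col b (m′ zero)) m₀≡b (proj₁ digits≡)
    on-port (suc zero) m₁≡b = subst (λ v → col a v ≡ col b (m′ (suc zero))) m₁≡b (proj₂ digits≡)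

-- A node with m reduction rounds still to go has a colour of at most width m
-- bits: an identifier ℓ ≤ tower L fits in width L bits, and one round turns
-- colours of width (suc m) bits into colours below palette (width (suc m)) ²,
-- which is at most 2 ^ width m.
width : ℕ → ℕ
width m = (tower m + 4) * 2

4P+19≤16P : ∀ {P} → 2 ≤ P → 3 + (P + 4) * 2 * 2 ≤ P * 16
4P+19≤16P {P} 2≤P = begin
  3 + (P + 4) * 2 * 2 ≡⟨ expand P ⟩
  19 + 4 * P          ≤⟨ +-monoˡ-≤ (4 * P) (m≤m+n 19 5) ⟩
  12 * 2 + 4 * P      ≤⟨ +-monoˡ-≤ (4 * P) (*-monoʳ-≤ 12 2≤P) ⟩
  12 * P + 4 * P      ≡⟨ collect P ⟩
  P * 16              ∎
  where
    open ≤-Reasoning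
    expand : ∀ P → 3 + (P + 4) * 2 * 2 ≡ 19 + 4 * P
    expand = solve-∀
    collect : ∀ P → 12 * P + 4 * P ≡ P * 16
    collect = solve-∀

palette-width-step : ∀ m → palette (width (suc m)) * palette (width (suc m)) ≤ 2 ^ width m
palette-width-step m = begin
  palette (width (suc m)) * palette (width (suc m)) ≤⟨ *-mono-≤ palette≤Q palette≤Q ⟩
  Q * Q                                             ≡⟨ cong (Q *_) (*-identityʳ Q) ⟨
  Q ^ 2                                             ≡⟨ ^-*-assoc 2 (tower m + 4) 2 ⟩
  2 ^ width m                                       ∎
  where
    open ≤-Reasoning
    Q = 2 ^ (tower m + 4)
    palette≤Q : palette (width (suc m)) ≤ Q
    palette≤Q = subst (palette (width (suc m)) ≤_) (sym (^-distribˡ-+-* 2 (tower m) 4))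
                      (4P+19≤16P (^-monoʳ-≤ 2 (1≤tower m)))

<2^width : ∀ {n} m → n ≤ tower m → n < 2 ^ width m
<2^width {n} m n≤tower = begin-strict
  n           ≤⟨ n≤tower ⟩
  tower m     <⟨ n<2^n (tower m) ⟩
  2 ^ tower m ≤⟨ ^-monoʳ-≤ 2 (≤-trans (m≤m+n (tower m) 4) (m≤m*n (tower m + 4) 2)) ⟩
  2 ^ width m ∎
  where open ≤-Reasoning

avoid : ∀ {n} → Fin (3 + n) → Fin (3 + n) → Fin (3 + n)
avoid c d with c Fin.≟ d
... | yes _   = punchIn c zero
... | no c≢d = punchIn c (punchIn (punchOut c≢d) zero)

avoid≢ˡ : ∀ {n} (c d : Fin (3 + n)) → avoid c d ≢ c
avoid≢ˡ c d with c Fin.≟ d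
... | yes _   = punchInᵢ≢i c zero
... | no c≢d = punchInᵢ≢i c (punchIn (punchOut c≢d) zero)

avoid≢ʳ : ∀ {n} (c d : Fin (3 + n)) → avoid c d ≢ d
avoid≢ʳ c d with c Fin.≟ d
... | yes refl = punchInᵢ≢i c zero
... | no c≢d   = λ eq → punchInᵢ≢i (punchOut c≢d) zero
  (punchIn-injective c _ _ (trans eq (sym (punchIn-punchOut c≢d))))

module ExecutionFacts (A : LocalAlgorithm) (ℓ : ℤ → ℕ) (π : PortNumbering) where
  open LocalAlgorithm A
  open Execution A ℓ π

  fromLeft fromRight : ℕ → ℤ → Maybe Msg
  fromLeft  t x = emit (run t (left x)) (portR (left x))
  fromRight t x = emit (run t (right x)) (portL (right x))

  inbox : ℕ → ℤ → Fin 2 → Maybe Msg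
  inbox t x = lookup (if π x then fromLeft t x ∷ fromRight t x ∷ []
                             else fromRight t x ∷ fromLeft t x ∷ [])

  Wired : ℤ → Fin 2 → ℤ → Fin 2 → Set
  Wired x p y q = ∀ t → inbox t x p ≡ emit (run t y) q

  wired-left : ∀ x → Wired x (portL x) (left x) (portR (left x))
  wired-left x t with π x
  ... | true  = refl
  ... | false = refl

  wired-right : ∀ x → Wired x (portR x) (right x) (portL (right x))
  wired-right x t with π x
  ... | true  = refl
  ... | false = refl

  left-right : ∀ x → left (right x) ≡ x
  left-right x = trans (ℤ.+-assoc x (ℤ.+ 1) (ℤ.- ℤ.+ 1)) (ℤ.+-identityʳ x)

  wired-back : ∀ x → Wired (right x) (portL (right x)) x (portR x)
  wired-back x = subst (λ z → Wired (right x) (portL (right x)) z (portR z)) (left-right x)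
                       (wired-left (right x))

  emit-live : ∀ s p → out s ≡ nothing → emit s p ≡ just (send s p)
  emit-live s p live with out s
  emit-live s p refl | nothing = refl

  emit-halted : ∀ s p {c} → out s ≡ just c → emit s p ≡ nothing
  emit-halted s p halted with out s
  emit-halted s p refl | just _ = refl

  run-live : ∀ t x → out (run t x) ≡ nothing →
             run (suc t) x ≡ step (run t x) (inbox t x zero) (inbox t x (suc zero))
  run-live t x live with out (run t x)
  run-live t x refl | nothing with π x
  ... | true  = refl
  ... | false = refl

  run-halted : ∀ t x {c} → out (run t x) ≡ just c → run (suc t) x ≡ run t x
  run-halted t x halted with out (run t x)
  run-halted t x refl | just _ = refl

  halted-forever : ∀ x {t t′ c} → out (run t x) ≡ just c → t ≤ t′ → out (run t′ x) ≡ just c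
  halted-forever x {c = c} halted =
    induction-from (λ t′ → out (run t′ x) ≡ just c) halted
      (λ {t′} _ halted′ → trans (cong out (run-halted t′ x halted′)) halted′)

  run-preserves : (P : State → Set) → (∀ s m₀ m₁ → P s → P (step s m₀ m₁)) →
                  ∀ t x → P (init (ℓ x)) → P (run t x)
  run-preserves P preserved zero    x P₀ = P₀
  run-preserves P preserved (suc t) x P₀ with out (run t x)
  ... | just _  = run-preserves P preserved t x P₀
  ... | nothing with π x
  ...   | true  = preserved _ _ _ (run-preserves P preserved t x P₀)
  ...   | false = preserved _ _ _ (run-preserves P preserved t x P₀)

record State : Set where
  field
    label    : ℕ
    round    : ℕ
    colour   : ℕ
    heard    : Fin 2 → Maybe (Fin 3)
    decision : Maybe (Fin 3)
open State

-- Opaque, so that the typechecker never unfolds κ * n into 2048 additions.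
opaque
  κ : ℕ
  κ = 2048

  κ≡2048 : κ ≡ 2048
  κ≡2048 = refl

rank : State → ℕ
rank s = log* (label s)

-- Final Cole–Vishkin colours are below 1024 = 2 ^ width 0, so the rank and the
-- colour can be read off the decision round.
decisionRound : State → ℕ
decisionRound s = colour s + rank s * 1024

-- An empty slot is read as colour 0; avoiding it as well is harmless.
choose : (Fin 2 → Maybe (Fin 3)) → Fin 3
choose h = avoid (fromMaybe zero (h zero)) (fromMaybe zero (h (suc zero)))

sameRankColour : ℕ → Maybe State → Maybe ℕ
sameRankColour L nothing  = nothing
sameRankColour L (just r) = if does (rank r ≟ L) then just (colour r) else nothing

initial : ℕ → State
initial n = record { label = n ; round = 0 ; colour = n ; heard = λ _ → nothing ; decision = nothing }

step : State → Maybe State → Maybe State → State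
step s m₀ m₁ = record
  { label    = label s
  ; round    = suc (round s)
  ; colour   = if does (round s <? rank s)
               then reduce (width (rank s ∸ round s)) (colour s)
                           (sameRankColour (rank s) m₀) (sameRankColour (rank s) m₁)
               else colour s
  ; heard    = heard′
  ; decision = if does (suc (round s) ≟ decisionRound s) then just (choose heard′) else decision s
  }
  where
    incoming : Fin 2 → Maybe State
    incoming zero       = m₀
    incoming (suc zero) = m₁
    heard′ : Fin 2 → Maybe (Fin 3)
    heard′ p = maybe′ decision (heard s p) (incoming p)

result : State → Maybe (Fin 3)
result s = if does (round s ≟ κ * rank s) then decision s else nothing

algorithm : LocalAlgorithm
algorithm = record
  { State = State
  ; Msg   = State
  ; init  = initial
  ; send  = λ s _ → s
  ; step  = step
  ; out   = result
  }

At : ℕ → ℕ → State → Set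
At L t s = rank s ≡ L × round s ≡ t

module _ {L t : ℕ} (s : State) (m : Fin 2 → Maybe State) where

  colour-step-reduce : At L t s → t < L →
    colour (step s (m zero) (m (suc zero)))
      ≡ reduce (width (L ∸ t)) (colour s) (sameRankColour L (m zero)) (sameRankColour L (m (suc zero)))
  colour-step-reduce (refl , refl) t<L rewrite dec-true (round s <? rank s) t<L = refl

  colour-step-keep : At L t s → L ≤ t → colour (step s (m zero) (m (suc zero))) ≡ colour s
  colour-step-keep (refl , refl) L≤t rewrite dec-false (round s <? rank s) (≤⇒≯ L≤t) = refl

  decision-step-choose : ∀ {c} → At L t s → colour s ≡ c → suc t ≡ c + L * 1024 →
    decision (step s (m zero) (m (suc zero))) ≡ just (choose (heard (step s (m zero) (m (suc zero)))))
  decision-step-choose (refl , refl) refl due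
    rewrite dec-true (suc (round s) ≟ decisionRound s) due = refl

  decision-step-keep : ∀ {c} → At L t s → colour s ≡ c → suc t ≢ c + L * 1024 →
    decision (step s (m zero) (m (suc zero))) ≡ decision s
  decision-step-keep (refl , refl) refl not-due
    rewrite dec-false (suc (round s) ≟ decisionRound s) not-due = refl

heard-step : ∀ s (m : Fin 2 → Maybe State) p →
             heard (step s (m zero) (m (suc zero))) p ≡ maybe′ decision (heard s p) (m p)
heard-step s m zero       = refl
heard-step s m (suc zero) = refl

result-early : ∀ {L t} s → At L t s → t < κ * L → result s ≡ nothing
result-early s (refl , refl) t<κL rewrite dec-false (round s ≟ κ * rank s) (<⇒≢ t<κL) = refl

result-on-time : ∀ {L} s → At L (κ * L) s → result s ≡ decision s
result-on-time s (refl , round≡) rewrite dec-true (round s ≟ κ * rank s) round≡ = refl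

sameRankColour-same : ∀ {L} r → rank r ≡ L → sameRankColour L (just r) ≡ just (colour r)
sameRankColour-same {L} r rank≡L rewrite dec-true (rank r ≟ L) rank≡L = refl

choose-avoids : ∀ h p {c} → h p ≡ just c → choose h ≢ c
choose-avoids h zero       {c} h₀≡c rewrite h₀≡c = avoid≢ˡ c _
choose-avoids h (suc zero) {c} h₁≡c rewrite h₁≡c = avoid≢ʳ (fromMaybe zero (h zero)) c

module Correctness (ℓ : ℤ → ℕ) (ℓ>1 : ∀ x → 1 < ℓ x) (proper : ProperLabeling ℓ) (π : PortNumbering)
  where
  open Execution algorithm ℓ π
  open ExecutionFacts algorithm ℓ π

  L T : ℤ → ℕ
  L x = log* (ℓ x)
  T x = κ * L x

  1≤L : ∀ x → 1 ≤ L x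
  1≤L x = 1≤log* (ℓ>1 x)

  L≤T : ∀ x → L x ≤ T x
  L≤T x = subst (λ k → L x ≤ k * L x) (sym κ≡2048) (m≤n*m (L x) 2048)

  label-run : ∀ t x → label (run t x) ≡ ℓ x
  label-run t x = run-preserves (λ s → label s ≡ ℓ x) (λ _ _ _ label≡ → label≡) t x refl

  round-run : ∀ {t x} → t ≤ T x → round (run t x) ≡ t
  at : ∀ {t x} → t ≤ T x → At (L x) t (run t x)
  live : ∀ {t x} → t < T x → output t x ≡ nothing

  round-run {zero}  _   = refl
  round-run {suc t} {x} t<T =
    trans (cong round (run-live t x (live t<T))) (cong suc (round-run (<⇒≤ t<T)))
  at {t} {x} t≤T = cong log* (label-run t x) , round-run t≤T
  live {t} {x} t<T = result-early (run t x) (at (<⇒≤ t<T)) t<T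

  step-run : ∀ {t x} → t < T x →
             run (suc t) x ≡ step (run t x) (inbox t x zero) (inbox t x (suc zero))
  step-run {t} {x} t<T = run-live t x (live t<T)

  peerColours : ℕ → ℤ → Fin 2 → Maybe ℕ
  peerColours t x p = sameRankColour (L x) (inbox t x p)

  colour-run-reduce : ∀ {t x} → t < L x →
    colour (run (suc t) x)
      ≡ reduce (width (L x ∸ t)) (colour (run t x)) (peerColours t x zero) (peerColours t x (suc zero))
  colour-run-reduce {t} {x} t<L =
    trans (cong colour (step-run t<T)) (colour-step-reduce (run t x) (inbox t x) (at (<⇒≤ t<T)) t<L)
    where t<T = <-≤-trans t<L (L≤T x)

  colour-bound : ∀ t x → t ≤ L x → colour (run t x) < 2 ^ width (L x ∸ t)
  colour-bound zero    x _   = <2^width (L x) (n≤tower[log*n] (ℓ x))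
  colour-bound (suc t) x t<L = begin-strict
    colour (run (suc t) x)         ≡⟨ colour-run-reduce t<L ⟩
    reduce k a (m zero) (m (suc zero)) <⟨ reduce<palette² k a (m zero) (m (suc zero)) ⟩
    palette k * palette k          ≡⟨ cong (λ r → palette (width r) * palette (width r)) rounds-left ⟩
    palette k′ * palette k′        ≤⟨ palette-width-step (L x ∸ suc t) ⟩
    2 ^ width (L x ∸ suc t)        ∎
    where
      open ≤-Reasoning
      k = width (L x ∸ t)
      k′ = width (suc (L x ∸ suc t))
      rounds-left = m∸n≡1+[m∸1+n] t<L
      a = colour (run t x)
      m = peerColours t x

  right-peer : ∀ {t x} → L (right x) ≡ L x → t < T (right x) →
               peerColours t x (portR x) ≡ just (colour (run t (right x)))
  right-peer {t} {x} L≡ t<T = trans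
    (cong (sameRankColour (L x)) (trans (wired-right x t) (emit-live (run t y) (portL y) (live t<T))))
    (sameRankColour-same (run t y) (trans (cong log* (label-run t y)) L≡))
    where y = right x

  colour-proper : ∀ t x → L x ≡ L (right x) → t ≤ L x → colour (run t x) ≢ colour (run t (right x))
  colour-proper zero    x _  _   = proper x
  colour-proper (suc t) x L≡ t<L eq =
    reduce-proper k (peerColours t x) (peerColours t y) (portR x) (colour-bound t x (<⇒≤ t<L)) b-bound
      (colour-proper t x L≡ (<⇒≤ t<L)) (right-peer (sym L≡) (<-≤-trans t<Ly (L≤T y)))
      (trans (sym (colour-run-reduce t<L)) (trans eq y-reduces))
    where
      y = right x
      k = width (L x ∸ t)
      b = colour (run t y)
      m′ = peerColours t y
      t<Ly : t < L y
      t<Ly = subst (t <_) L≡ t<L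
      b-bound : b < 2 ^ k
      b-bound = subst (λ n → b < 2 ^ width (n ∸ t)) (sym L≡) (colour-bound t y (<⇒≤ t<Ly))
      y-reduces : colour (run (suc t) y) ≡ reduce k b (m′ zero) (m′ (suc zero))
      y-reduces = trans (colour-run-reduce t<Ly)
                        (cong (λ n → reduce (width (n ∸ t)) b (m′ zero) (m′ (suc zero))) (sym L≡))

  colour-run-keep : ∀ {t x} → L x ≤ t → t < T x → colour (run (suc t) x) ≡ colour (run t x)
  colour-run-keep {t} {x} L≤t t<T =
    trans (cong colour (step-run t<T)) (colour-step-keep (run t x) (inbox t x) (at (<⇒≤ t<T)) L≤t)

  cv : ℤ → ℕ
  cv x = colour (run (L x) x)

  cv<1024 : ∀ x → cv x < 1024
  cv<1024 x = subst (λ r → cv x < 2 ^ width r) (n∸n≡0 (L x)) (colour-bound (L x) x ≤-refl)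

  cv-proper : ∀ x → L x ≡ L (right x) → cv x ≢ cv (right x)
  cv-proper x L≡ = subst (λ n → cv x ≢ colour (run n (right x))) L≡ (colour-proper (L x) x L≡ ≤-refl)

  colour-frozen : ∀ {t x} → L x ≤ t → t ≤ T x → colour (run t x) ≡ cv x
  colour-frozen {x = x} = induction-from (λ t → t ≤ T x → colour (run t x) ≡ cv x) (λ _ → refl)
    (λ L≤t frozen t<T → trans (colour-run-keep L≤t t<T) (frozen (<⇒≤ t<T)))

  D : ℤ → ℕ
  D x = cv x + L x * 1024

  L<D : ∀ x → L x < D x
  L<D x = <-≤-trans (m<m*n (L x) 1024 {{>-nonZero (1≤L x)}} (s≤s (s≤s z≤n)))
                    (m≤n+m (L x * 1024) (cv x))

  D<T : ∀ x → D x < T x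
  D<T x = begin-strict
    cv x + L x * 1024       <⟨ +-monoˡ-< (L x * 1024) (cv<1024 x) ⟩
    1024 + L x * 1024       ≤⟨ +-monoˡ-≤ (L x * 1024) (*-monoˡ-≤ 1024 (1≤L x)) ⟩
    L x * 1024 + L x * 1024 ≡⟨ *-distribˡ-+ (L x) 1024 1024 ⟨
    L x * 2048              ≡⟨ *-comm (L x) 2048 ⟩
    2048 * L x              ≡⟨ cong (_* L x) κ≡2048 ⟨
    T x                     ∎
    where open ≤-Reasoning

  D-proper : ∀ x → D x ≢ D (right x)
  D-proper x D≡ = cv-proper x (proj₂ digits≡) (proj₁ digits≡)
    where digits≡ = digits-injective 1024 (cv<1024 x) (cv<1024 (right x)) D≡

  chosen : ℤ → Fin 3
  chosen x = choose (heard (run (D x) x))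

  decision-at-D : ∀ x → decision (run (D x) x) ≡ just (chosen x)
  decision-at-D x = decides (D x) refl
    where
      decides : ∀ t → t ≡ D x → decision (run t x) ≡ just (choose (heard (run t x)))
      decides zero    0≡D = contradiction (subst (L x <_) (sym 0≡D) (L<D x)) λ ()
      decides (suc t) 1+t≡D =
        subst (λ s → decision s ≡ just (choose (heard s))) (sym (step-run t<T))
          (decision-step-choose (run t x) (inbox t x) (at (<⇒≤ t<T)) (colour-frozen L≤t (<⇒≤ t<T)) 1+t≡D)
        where
          L≤t : L x ≤ t
          L≤t = s≤s⁻¹ (subst (L x <_) (sym 1+t≡D) (L<D x))
          t<T : t < T x
          t<T = <-trans (n<1+n t) (subst (_< T x) (sym 1+t≡D) (D<T x))

  decision-run-keep : ∀ {t x} → D x ≤ t → t < T x → decision (run (suc t) x) ≡ decision (run t x)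
  decision-run-keep {t} {x} D≤t t<T = trans (cong decision (step-run t<T))
    (decision-step-keep (run t x) (inbox t x) (at (<⇒≤ t<T)) (colour-frozen L≤t (<⇒≤ t<T))
                        (≢-sym (<⇒≢ (s≤s D≤t))))
    where L≤t = ≤-trans (<⇒≤ (L<D x)) D≤t

  decision-run : ∀ {t x} → D x ≤ t → t ≤ T x → decision (run t x) ≡ just (chosen x)
  decision-run {x = x} =
    induction-from (λ t → t ≤ T x → decision (run t x) ≡ just (chosen x)) (λ _ → decision-at-D x)
      (λ D≤t decided t<T → trans (decision-run-keep D≤t t<T) (decided (<⇒≤ t<T)))

  output-halted : ∀ {t x} → T x ≤ t → output t x ≡ just (chosen x)
  output-halted {x = x} = halted-forever x
    (trans (result-on-time (run (T x) x) (at ≤-refl)) (decision-run (<⇒≤ (D<T x)) ≤-refl))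

  heard-run : ∀ {t x} p → t < T x →
              heard (run (suc t) x) p ≡ maybe′ decision (heard (run t x) p) (inbox t x p)
  heard-run {t} {x} p t<T =
    trans (cong (λ s → heard s p) (step-run t<T)) (heard-step (run t x) (inbox t x) p)

  heard-from : ∀ {x p y q} → Wired x p y q →
               ∀ t → D y < t → t ≤ T x → heard (run t x) p ≡ just (chosen y)
  heard-from {x} {p} {y} {q} wired (suc t) (s≤s Dy≤t) t<Tx with t <? T y
  ... | yes t<Ty = begin
    heard (run (suc t) x) p                           ≡⟨ heard-run p t<Tx ⟩
    maybe′ decision (heard (run t x) p) (inbox t x p) ≡⟨ cong (maybe′ decision _) received ⟩
    decision (run t y)                                ≡⟨ decision-run Dy≤t (<⇒≤ t<Ty) ⟩
    just (chosen y)                                   ∎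
    where
      open ≡-Reasoning
      received = trans (wired t) (emit-live (run t y) q (live t<Ty))
  ... | no t≮Ty = begin
    heard (run (suc t) x) p                           ≡⟨ heard-run p t<Tx ⟩
    maybe′ decision (heard (run t x) p) (inbox t x p) ≡⟨ cong (maybe′ decision _) silent ⟩
    heard (run t x) p                                 ≡⟨ heard-from wired t (<-≤-trans (D<T y) T≤t) (<⇒≤ t<Tx) ⟩
    just (chosen y)                                   ∎
    where
      open ≡-Reasoning
      T≤t = ≮⇒≥ t≮Ty
      silent = trans (wired t) (emit-halted (run t y) q (output-halted T≤t))

  chosen-avoids : ∀ {x p y q} → Wired x p y q → D y < D x → chosen x ≢ chosen y
  chosen-avoids {x} {p} wired Dy<Dx =
    choose-avoids (heard (run (D x) x)) p (heard-from wired (D x) Dy<Dx (<⇒≤ (D<T x)))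

  chosen-proper : ∀ x → chosen x ≢ chosen (right x)
  chosen-proper x with <-cmp (D x) (D (right x))
  ... | tri< Dx<Dy _ _ = ≢-sym (chosen-avoids (wired-back x) Dx<Dy)
  ... | tri≈ _ D≡ _    = contradiction D≡ (D-proper x)
  ... | tri> _ _ Dy<Dx = chosen-avoids (wired-right x) Dy<Dx

  outputs-proper : ∀ x c d → output (T x) x ≡ just c → output (T (right x)) (right x) ≡ just d →
                   c ≢ d
  outputs-proper x c d out≡c out≡d c≡d = chosen-proper x (begin
    chosen x         ≡⟨ just-injective (trans (sym (output-halted ≤-refl)) out≡c) ⟩
    c                ≡⟨ c≡d ⟩
    d                ≡⟨ just-injective (trans (sym out≡d) (output-halted ≤-refl)) ⟩
    chosen (right x) ∎)
    where open ≡-Reasoning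

mainTheorem6 : Σ ℕ λ κ → 1 < κ × Σ LocalAlgorithm λ A →
    (ℓ : ℤ → ℕ) → ((x : ℤ) → 1 < ℓ x) → ProperLabeling ℓ → (π : PortNumbering) →
    let open Execution A ℓ π in
    ((x : ℤ) → Σ (Fin 3) λ c → output (κ * log* (ℓ x)) x ≡ just c)
    × ((x : ℤ) (c d : Fin 3) →
        output (κ * log* (ℓ x)) x ≡ just c →
        output (κ * log* (ℓ (right x))) (right x) ≡ just d →
        c ≢ d)
mainTheorem6 = κ , subst (1 <_) (sym κ≡2048) (s≤s (s≤s z≤n)) , algorithm , λ ℓ ℓ>1 proper π →
  let open Correctness ℓ ℓ>1 proper π in
  (λ x → chosen x , output-halted ≤-refl) , outputs-proper
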